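{- Let $G$ be an abelian group and $X=\{x\in G: o(x)=4\}$. If $\vec{x}=\langle x_n:n<\omega\rangle$ is a sequence of elements of $G$ with $\mathrm{FS}(\vec{x})\subseteq X$, then $\vec{x}$ satisfies the 2-uniqueness of finite sums.
   Context: $o(x)$ is the least positive integer $n$ with $nx=0$. $\mathrm{FS}(\vec{x})=\{\sum_{n\in a}x_n: a\subseteq\omega\text{ finite nonempty}\}$. A sequence $\vec{x}$ satisfies the 2-uniqueness of finite sums if whenever $a,b\subseteq\omega$ are finite and $\varepsilon:a\to\{1,2\}$, $\delta:b\to\{1,2\}$ satisfy $\sum_{n\in a}\varepsilon(n)x_n=\sum_{n\in b}\delta(n)x_n$, then $a=b$ and $\varepsilon=\delta$. -}

module Defs where

open import Level using (Level)
open import Data.Nat using (ℕ; zero; suc; _<_; _≤_)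
open import Data.Bool using (Bool; true; false)
open import Data.Fin using (Fin)
open import Data.Product using (Σ; ∃; _×_; _,_)
open import Relation.Nullary using (¬_)
open import Relation.Binary.PropositionalEquality using (_≡_)
open import Algebra.Bundles using (AbelianGroup)

module _ {c ℓ : Level} (G : AbelianGroup c ℓ) where
  open AbelianGroup G renaming (Carrier to A)

  mul : ℕ → A → A
  mul zero    x = ε
  mul (suc n) x = x ∙ mul n x

  HasOrder : A → ℕ → Set ℓ
  HasOrder x k = (0 < k) × (mul k x ≈ ε) × (∀ m → 0 < m → m < k → ¬ (mul m x ≈ ε))

  sumBelow : ℕ → (ℕ → A) → A
  sumBelow zero    f = ε
  sumBelow (suc N) f = sumBelow N f ∙ f N

NonEmpty : (ℕ → Bool) → Set
NonEmpty χ = ∃ λ n → χ n ≡ true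

module _ {c ℓ : Level} (G : AbelianGroup c ℓ) where
  open AbelianGroup G renaming (Carrier to A)

  boolMul : Bool → A → A
  boolMul true  x = x
  boolMul false x = ε

  finMul : Fin 3 → A → A
  finMul i x = mul G (Data.Fin.toℕ i) x

  -- FS(x⃗) ⊆ X, where X = {g | o(g) = 4}:
  -- for every finite nonempty a ⊆ ω (support below N), Σ_{n∈a} x_n has order 4
  FSSubsetOrder4 : (ℕ → A) → Set ℓ
  FSSubsetOrder4 x = ∀ (χ : ℕ → Bool) (N : ℕ) → (∀ n → N ≤ n → χ n ≡ false) →
                     NonEmpty χ →
                     HasOrder G (sumBelow G N (λ n → boolMul (χ n) (x n))) 4

  -- 2-uniqueness of finite sums: a finite a ⊆ ω with ε : a → {1,2} is encoded as
  -- e : ℕ → Fin 3 with a = {n | e n ≠ 0}, ε = e on a; both supports lie below N.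
  -- a = b and ε = δ  is then exactly  e = d  pointwise.
  TwoUnique : (ℕ → A) → Set ℓ
  TwoUnique x = ∀ (e d : ℕ → Fin 3) (N : ℕ) →
                (∀ n → N ≤ n → e n ≡ Data.Fin.zero) →
                (∀ n → N ≤ n → d n ≡ Data.Fin.zero) →
                sumBelow G N (λ n → finMul (e n) (x n)) ≈ sumBelow G N (λ n → finMul (d n) (x n)) →
                ∀ n → e n ≡ d n

-- Put y n = 2 x n. Every x n lies in FS(x), so it has order 4 and 2 y n = 0.
-- Distinct finite sets a, b give distinct sums of the y n: otherwise the sum s of the
-- x n over the symmetric difference satisfies 2 s = Σ_a y + Σ_b y = 2 Σ_b y = 0,
-- contradicting o(s) = 4. Writing ε(n) = lowBit + 2 highBit, doubling an equation
-- Σ ε(n) x n = Σ δ(n) x n kills the high bits and gives {ε = 1} = {δ = 1}; cancelling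
-- the low bits then gives {ε = 2} = {δ = 2}.
module Submission where

open import Defs
open import Level using (Level)
open import Data.Nat using (ℕ; zero; suc; _<_; _≤_; _≟_; z≤n; s≤s)
open import Data.Nat.Properties using (≤-refl; m≤n⇒m≤1+n; <⇒≢; >⇒≢)
open import Data.Bool using (Bool; true; false; _xor_)
open import Data.Fin using (Fin)
open import Data.Fin.Patterns using (0F; 1F; 2F)
open import Data.Product using (_,_)
open import Relation.Nullary using (¬_; does; contradiction)
open import Relation.Nullary.Decidable using (dec-true; dec-false)
open import Relation.Binary.PropositionalEquality as ≡ using (_≡_; refl)
open import Algebra.Bundles using (AbelianGroup)

xor≢true⇒≡ : ∀ a b → ¬ (a xor b ≡ true) → a ≡ b
xor≢true⇒≡ true  true  _ = refl
xor≢true⇒≡ false false _ = refl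
xor≢true⇒≡ true  false h = contradiction refl h
xor≢true⇒≡ false true  h = contradiction refl h

singleton : ℕ → ℕ → Bool
singleton n m = does (m ≟ n)

lowBit highBit : Fin 3 → Bool
lowBit 0F = false
lowBit 1F = true
lowBit 2F = false
highBit 0F = false
highBit 1F = false
highBit 2F = true

fromBits : Bool → Bool → Fin 3
fromBits true  _     = 1F
fromBits false true  = 2F
fromBits false false = 0F

fromBits-bits : ∀ i → fromBits (lowBit i) (highBit i) ≡ i
fromBits-bits 0F = refl
fromBits-bits 1F = refl
fromBits-bits 2F = refl

bits-injective : ∀ {i j} → lowBit i ≡ lowBit j → highBit i ≡ highBit j → i ≡ j
bits-injective {i} {j} low high = begin
  i                                 ≡⟨ ≡.sym (fromBits-bits i) ⟩
  fromBits (lowBit i) (highBit i)   ≡⟨ ≡.cong₂ fromBits low high ⟩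
  fromBits (lowBit j) (highBit j)   ≡⟨ fromBits-bits j ⟩
  j                                 ∎
  where open ≡.≡-Reasoning

module AbelianGroupSums {c ℓ : Level} (G : AbelianGroup c ℓ) where
  open AbelianGroup G renaming (Carrier to A; refl to ≈-refl; sym to ≈-sym; trans to ≈-trans)
  open import Algebra.Properties.CommutativeSemigroup commutativeSemigroup using (interchange)

  ∑ : ℕ → (ℕ → A) → A
  ∑ = sumBelow G

  ∑-cong : ∀ N {f g : ℕ → A} → (∀ n → f n ≈ g n) → ∑ N f ≈ ∑ N g
  ∑-cong zero    f≈g = ≈-refl
  ∑-cong (suc N) f≈g = ∙-cong (∑-cong N f≈g) (f≈g N)

  ∑-∙ : ∀ N (f g : ℕ → A) → ∑ N (λ n → f n ∙ g n) ≈ ∑ N f ∙ ∑ N g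
  ∑-∙ zero    f g = ≈-sym (identityˡ ε)
  ∑-∙ (suc N) f g = ≈-trans (∙-congʳ (∑-∙ N f g)) (interchange _ _ _ _)

  ∑-ε : ∀ N (f : ℕ → A) → (∀ n → n < N → f n ≈ ε) → ∑ N f ≈ ε
  ∑-ε zero    f f≈ε = ≈-refl
  ∑-ε (suc N) f f≈ε =
    ≈-trans (∙-cong (∑-ε N f (λ n n<N → f≈ε n (m≤n⇒m≤1+n n<N))) (f≈ε N ≤-refl)) (identityˡ ε)

  ∑-singleton : ∀ n (z : ℕ → A) → ∑ (suc n) (λ m → boolMul G (singleton n m) (z m)) ≈ z n
  ∑-singleton n z rewrite dec-true (n ≟ n) refl =
    ≈-trans (∙-congʳ (∑-ε n _ outside)) (identityˡ (z n))
    where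
    outside : ∀ m → m < n → boolMul G (singleton n m) (z m) ≈ ε
    outside m m<n rewrite dec-false (m ≟ n) (<⇒≢ m<n) = ≈-refl

  HasOrder-mul≈ε : ∀ {u k} → HasOrder G u k → mul G k u ≈ ε
  HasOrder-mul≈ε (_ , kx≈ε , _) = kx≈ε

  HasOrder4⇒mul2≉ε : ∀ {u} → HasOrder G u 4 → ¬ (mul G 2 u ≈ ε)
  HasOrder4⇒mul2≉ε (_ , _ , minimal) = minimal 2 (s≤s z≤n) (s≤s (s≤s (s≤s z≤n)))

  mul4≈double∙double : ∀ z → mul G 4 z ≈ (z ∙ z) ∙ (z ∙ z)
  mul4≈double∙double z =
    ≈-sym (≈-trans (assoc _ _ _) (∙-congˡ (∙-congˡ (∙-congˡ (≈-sym (identityʳ z))))))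

  mul-cong : ∀ k {u v} → u ≈ v → mul G k u ≈ mul G k v
  mul-cong zero    u≈v = ≈-refl
  mul-cong (suc k) u≈v = ∙-cong u≈v (mul-cong k u≈v)

  boolMul-double : ∀ b z → boolMul G b (z ∙ z) ≈ boolMul G b z ∙ boolMul G b z
  boolMul-double true  z = ≈-refl
  boolMul-double false z = ≈-sym (identityˡ ε)

  boolMul-selfInverse : ∀ b {z} → z ∙ z ≈ ε → boolMul G b z ∙ boolMul G b z ≈ ε
  boolMul-selfInverse true  zz≈ε = zz≈ε
  boolMul-selfInverse false zz≈ε = identityˡ ε

  boolMul-xor : ∀ a b {z} → z ∙ z ≈ ε → boolMul G (a xor b) z ≈ boolMul G a z ∙ boolMul G b z
  boolMul-xor true  true  zz≈ε = ≈-sym zz≈ε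
  boolMul-xor true  false zz≈ε = ≈-sym (identityʳ _)
  boolMul-xor false true  zz≈ε = ≈-sym (identityˡ _)
  boolMul-xor false false zz≈ε = ≈-sym (identityˡ ε)

  finMul-bits : ∀ i z → finMul G i z ≈ boolMul G (lowBit i) z ∙ boolMul G (highBit i) (z ∙ z)
  finMul-bits 0F z = ≈-sym (identityˡ ε)
  finMul-bits 1F z = ≈-refl
  finMul-bits 2F z = ≈-trans (∙-congˡ (identityʳ z)) (≈-sym (identityˡ _))

  finMul-double : ∀ i {z} → (z ∙ z) ∙ (z ∙ z) ≈ ε →
                  finMul G i z ∙ finMul G i z ≈ boolMul G (lowBit i) (z ∙ z)
  finMul-double 0F zzzz≈ε = identityˡ ε
  finMul-double 1F zzzz≈ε = ∙-cong (identityʳ _) (identityʳ _)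
  finMul-double 2F zzzz≈ε =
    ≈-trans (∙-cong (∙-congˡ (identityʳ _)) (∙-congˡ (identityʳ _))) zzzz≈ε

  ∑∈ : (ℕ → Bool) → ℕ → (ℕ → A) → A
  ∑∈ χ N z = ∑ N (λ n → boolMul G (χ n) (z n))

  ∑∈-cong : ∀ {χ ψ} N {z} → (∀ n → χ n ≡ ψ n) → ∑∈ χ N z ≈ ∑∈ ψ N z
  ∑∈-cong N {z} χ≡ψ = ∑-cong N (λ n → reflexive (≡.cong (λ b → boolMul G b (z n)) (χ≡ψ n)))

  ∑∈-double : ∀ χ N z → ∑∈ χ N (λ n → z n ∙ z n) ≈ ∑∈ χ N z ∙ ∑∈ χ N z
  ∑∈-double χ N z = ≈-trans (∑-cong N (λ n → boolMul-double (χ n) (z n))) (∑-∙ N _ _)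

  ∑∈-selfInverse : ∀ χ N {z} → (∀ n → z n ∙ z n ≈ ε) → ∑∈ χ N z ∙ ∑∈ χ N z ≈ ε
  ∑∈-selfInverse χ N zz≈ε =
    ≈-trans (≈-sym (∑-∙ N _ _)) (∑-ε N _ (λ n _ → boolMul-selfInverse (χ n) (zz≈ε n)))

  ∑∈-xor : ∀ χ ψ N {z} → (∀ n → z n ∙ z n ≈ ε) →
           ∑∈ (λ n → χ n xor ψ n) N z ≈ ∑∈ χ N z ∙ ∑∈ ψ N z
  ∑∈-xor χ ψ N zz≈ε = ≈-trans (∑-cong N (λ n → boolMul-xor (χ n) (ψ n) (zz≈ε n))) (∑-∙ N _ _)

  ∑· : (ℕ → Fin 3) → ℕ → (ℕ → A) → A
  ∑· e N z = ∑ N (λ n → finMul G (e n) (z n))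

  ∑·-bits : ∀ e N z →
            ∑· e N z ≈ ∑∈ (λ n → lowBit (e n)) N z ∙ ∑∈ (λ n → highBit (e n)) N (λ n → z n ∙ z n)
  ∑·-bits e N z = ≈-trans (∑-cong N (λ n → finMul-bits (e n) (z n))) (∑-∙ N _ _)

  ∑·-double : ∀ e N {z} → (∀ n → (z n ∙ z n) ∙ (z n ∙ z n) ≈ ε) →
              ∑· e N z ∙ ∑· e N z ≈ ∑∈ (λ n → lowBit (e n)) N (λ n → z n ∙ z n)
  ∑·-double e N zzzz≈ε =
    ≈-trans (≈-sym (∑-∙ N _ _)) (∑-cong N (λ n → finMul-double (e n) (zzzz≈ε n)))

module FSOfOrder4 {c ℓ : Level} (G : AbelianGroup c ℓ) (x : ℕ → AbelianGroup.Carrier G)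
                  (fs⊆X : FSSubsetOrder4 G x) where
  open AbelianGroup G renaming (Carrier to A; refl to ≈-refl; sym to ≈-sym; trans to ≈-trans)
  open AbelianGroupSums G
  open import Algebra.Properties.Group group using (∙-cancelˡ)
  open import Relation.Binary.Reasoning.Setoid setoid

  y : ℕ → A
  y n = x n ∙ x n

  y-selfInverse : ∀ n → y n ∙ y n ≈ ε
  y-selfInverse n = begin
    y n ∙ y n                              ≈⟨ mul4≈double∙double (x n) ⟨
    mul G 4 (x n)                          ≈⟨ mul-cong 4 (∑-singleton n x) ⟨
    mul G 4 (∑∈ (singleton n) (suc n) x)   ≈⟨ HasOrder-mul≈ε (fs⊆X (singleton n) (suc n) outside (n , inside)) ⟩
    ε                                      ∎
    where
    inside : singleton n n ≡ true
    inside = dec-true (n ≟ n) refl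
    outside : ∀ m → suc n ≤ m → singleton n m ≡ false
    outside m n<m = dec-false (m ≟ n) (>⇒≢ n<m)

  ∑∈-y-injective : ∀ χ ψ N → (∀ n → N ≤ n → χ n ≡ false) → (∀ n → N ≤ n → ψ n ≡ false) →
                   ∑∈ χ N y ≈ ∑∈ ψ N y → ∀ n → χ n ≡ ψ n
  ∑∈-y-injective χ ψ N χ⊆N ψ⊆N ∑χ≈∑ψ n = xor≢true⇒≡ (χ n) (ψ n) λ n∈ξ →
    HasOrder4⇒mul2≉ε (fs⊆X ξ N ξ⊆N (n , n∈ξ)) twice-s≈ε
    where
    ξ : ℕ → Bool
    ξ m = χ m xor ψ m
    ξ⊆N : ∀ m → N ≤ m → ξ m ≡ false
    ξ⊆N m N≤m rewrite χ⊆N m N≤m | ψ⊆N m N≤m = refl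
    s : A
    s = ∑∈ ξ N x
    twice-s≈ε : mul G 2 s ≈ ε
    twice-s≈ε = begin
      s ∙ (s ∙ ε)                    ≈⟨ ∙-congˡ (identityʳ s) ⟩
      s ∙ s                          ≈⟨ ∑∈-double ξ N x ⟨
      ∑∈ ξ N y                       ≈⟨ ∑∈-xor χ ψ N y-selfInverse ⟩
      ∑∈ χ N y ∙ ∑∈ ψ N y            ≈⟨ ∙-congʳ ∑χ≈∑ψ ⟩
      ∑∈ ψ N y ∙ ∑∈ ψ N y            ≈⟨ ∑∈-selfInverse ψ N y-selfInverse ⟩
      ε                              ∎

  twoUnique : TwoUnique G x
  twoUnique e d N e⊆N d⊆N ∑e≈∑d n = bits-injective (sameLow n) (sameHigh n)
    where
    low high : (ℕ → Fin 3) → ℕ → Bool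
    low  f m = lowBit (f m)
    high f m = highBit (f m)
    sameLow : ∀ m → low e m ≡ low d m
    sameLow = ∑∈-y-injective (low e) (low d) N
                (λ m N≤m → ≡.cong lowBit (e⊆N m N≤m)) (λ m N≤m → ≡.cong lowBit (d⊆N m N≤m)) (begin
      ∑∈ (low e) N y         ≈⟨ ∑·-double e N y-selfInverse ⟨
      ∑· e N x ∙ ∑· e N x    ≈⟨ ∙-cong ∑e≈∑d ∑e≈∑d ⟩
      ∑· d N x ∙ ∑· d N x    ≈⟨ ∑·-double d N y-selfInverse ⟩
      ∑∈ (low d) N y         ∎)
    sameHigh : ∀ m → high e m ≡ high d m
    sameHigh = ∑∈-y-injective (high e) (high d) N
                 (λ m N≤m → ≡.cong highBit (e⊆N m N≤m)) (λ m N≤m → ≡.cong highBit (d⊆N m N≤m))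
                 (∙-cancelˡ (∑∈ (low e) N x) _ _ (begin
      ∑∈ (low e) N x ∙ ∑∈ (high e) N y    ≈⟨ ∑·-bits e N x ⟨
      ∑· e N x                            ≈⟨ ∑e≈∑d ⟩
      ∑· d N x                            ≈⟨ ∑·-bits d N x ⟩
      ∑∈ (low d) N x ∙ ∑∈ (high d) N y    ≈⟨ ∙-congʳ (∑∈-cong N (λ m → ≡.sym (sameLow m))) ⟩
      ∑∈ (low e) N x ∙ ∑∈ (high d) N y    ∎))

mainTheorem7 : ∀ {c ℓ : Level} (G : AbelianGroup c ℓ) (x : ℕ → AbelianGroup.Carrier G) →
               FSSubsetOrder4 G x → TwoUnique G x
mainTheorem7 G x fs⊆X = FSOfOrder4.twoUnique G x fs⊆X
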